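{- $\lim_{n\to\infty}\mathrm{avg}_1(K_n) = 2$, where $K_n$ is the complete graph on $n$ vertices.
   Context: Let $G=(V,E)$ be a finite connected graph with a fixed root $v_0$. A $1$-Lipschitz mapping of $G$ is a map $f:V\to\mathbb{Z}$ with $f(v_0)=0$ and $|f(u)-f(v)|\le 1$ for every edge $uv$; the set of these is $\mathcal{L}_1(G)$. The range of $f$ is $\mathrm{rng}(f)=|\{f(v):v\in V\}|$, and $\mathrm{avg}_1(G)=\frac{\sum_{f\in\mathcal{L}_1(G)}\mathrm{rng}(f)}{|\mathcal{L}_1(G)|}$ (independent of the choice of root). -}

module Defs where

open import Data.Nat as ℕ using (ℕ; zero; suc)
open import Data.Integer as ℤ using (ℤ; +_)
open import Data.Fin using (Fin)
import Data.Fin as Fin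
open import Data.Bool using (Bool; true; false; _∧_; not)
open import Data.List using (List; []; _∷_; map; concatMap; filter; length; upTo; deduplicate; allFin)
open import Data.Nat.ListAction using (sum)
open import Data.Bool.ListAction using (all)
open import Data.Vec using (Vec; []; _∷_; lookup; toList)
open import Data.Rational using (ℚ; _/_; 0ℚ)
open import Relation.Nullary.Decidable using (⌊_⌋)

Adj : ℕ → Set
Adj m = Fin m → Fin m → Bool

complete : (m : ℕ) → Adj m
complete m i j = not ⌊ i Fin.≟ j ⌋

allVecs : (k : ℕ) → List ℤ → List (Vec ℤ k)
allVecs zero    vs = [] ∷ []
allVecs (suc k) vs = concatMap (λ x → map (x ∷_) (allVecs k vs)) vs

window : ℕ → List ℤ
window n = map (λ k → (+ k) ℤ.- (+ n)) (upTo (suc (2 ℕ.* n)))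

close : ℤ → ℤ → Bool
close a b = ⌊ ℤ.∣ a ℤ.- b ∣ ℕ.≤? 1 ⌋

isLip : ∀ {n} → Adj (suc n) → Vec ℤ (suc n) → Bool
isLip {n} G f =
  ⌊ lookup f Fin.zero ℤ.≟ + 0 ⌋ ∧
  all (λ i → all (λ j → not (G i j) Data.Bool.∨ close (lookup f i) (lookup f j)) (allFin (suc n))) (allFin (suc n))

-- Every 1-Lipschitz map of a connected graph
-- on n+1 vertices with f(v0)=0 takes values in [-n, n], so enumerating maps with
-- values in that window enumerates all of L_1(G) (each exactly once).
L1 : ∀ {n} → Adj (suc n) → List (Vec ℤ (suc n))
L1 {n} G = filter (λ f → Data.Bool._≟_ (isLip G f) true) (allVecs (suc n) (window n))

rng : ∀ {k} → Vec ℤ k → ℕ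
rng f = length (deduplicate ℤ._≟_ (toList f))

-- s / c as a rational (c = 0 never occurs for L_1, which contains the zero map).
divℕ : ℕ → ℕ → ℚ
divℕ s zero    = 0ℚ
divℕ s (suc c) = (+ s) / suc c

avg1 : ∀ {n} → Adj (suc n) → ℚ
avg1 G = divℕ (sum (map rng (L1 G))) (length (L1 G))

module Submission where

-- On the complete graph all vertices are pairwise adjacent, so a 1-Lipschitz map f with
-- f(v₀) = 0 takes its values in {0, e} for a single e ∈ {1, -1}: its range is 2, except for
-- the zero map, whose range is 1. Summing over the c maps of L₁(K_{n+1}) gives
-- Σ rng = 2c - 1, i.e. avg₁ = 2 - 1/c, and c ≥ 2ⁿ because every {0,1}-valued map vanishing
-- at the root is 1-Lipschitz.

module Counting where

  open import Algebra.Properties.CommutativeSemigroup using (interchange)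
  open import Data.Bool using (Bool; true; false; T; _∧_)
  import Data.Bool as Bool
  open import Data.Bool.ListAction using (all)
  open import Data.Empty using (⊥-elim)
  open import Data.List using (List; []; _∷_; map; filter; length; _++_; deduplicate)
  open import Data.List.Membership.Propositional using (_∈_)
  open import Data.List.Membership.Propositional.Properties using (∈-filter⁺; ∈-deduplicate⁺)
  open import Data.List.Properties using (filter-none)
  open import Data.List.Relation.Unary.All as All using (All; []; _∷_)
  import Data.List.Relation.Unary.All.Properties as All
  open import Data.List.Relation.Unary.AllPairs using (_∷_)
  open import Data.List.Relation.Unary.Any using (here; there; any?)
  open import Data.List.Relation.Unary.Unique.Propositional using (Unique)
  import Data.List.Relation.Unary.Unique.Propositional.Properties as Unique
  open import Data.Nat using (ℕ; suc; _+_; _*_; _≤_; z≤n; s≤s)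
  import Data.Nat.Properties as ℕ
  open import Data.Nat.ListAction using (sum)
  open import Data.Product using (_,_)
  open import Data.Sum using (_⊎_; inj₁; inj₂; [_,_]′)
  open import Function using (_∘_; id)
  open import Relation.Binary.Definitions using (DecidableEquality)
  open import Relation.Binary.PropositionalEquality
    using (_≡_; _≢_; refl; sym; trans; cong; cong₂; subst; module ≡-Reasoning)
  open import Relation.Nullary using (¬_; Dec; yes; no; ¬?)
  open import Relation.Nullary.Decidable
    using (⌊_⌋; isYes≗does; dec-true; dec-false; toWitness; fromWitness)

  iverson : Bool → ℕ
  iverson true  = 1
  iverson false = 0

  iverson-T : ∀ {b} → T b → iverson b ≡ 1
  iverson-T {true} _ = refl

  iverson-¬T : ∀ {b} → ¬ T b → iverson b ≡ 0
  iverson-¬T {true}  ¬t = ⊥-elim (¬t _)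
  iverson-¬T {false} _  = refl

  ⌊⌋-true : ∀ {P : Set} (P? : Dec P) → P → ⌊ P? ⌋ ≡ true
  ⌊⌋-true P? p = trans (isYes≗does P?) (dec-true P? p)

  ⌊⌋-false : ∀ {P : Set} (P? : Dec P) → ¬ P → ⌊ P? ⌋ ≡ false
  ⌊⌋-false P? ¬p = trans (isYes≗does P?) (dec-false P? ¬p)

  count : {A : Set} → (A → Bool) → List A → ℕ
  count p xs = sum (map (iverson ∘ p) xs)

  private
    +-interchange : ∀ a b c d → (a + b) + (c + d) ≡ (a + c) + (b + d)
    +-interchange = interchange ℕ.+-commutativeSemigroup

  module _ {A : Set} where

    count-cong : {p q : A → Bool} → (∀ x → p x ≡ q x) → ∀ xs → count p xs ≡ count q xs
    count-cong p≗q []       = refl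
    count-cong p≗q (x ∷ xs) = cong₂ _+_ (cong iverson (p≗q x)) (count-cong p≗q xs)

    count-++ : ∀ (p : A → Bool) xs ys → count p (xs ++ ys) ≡ count p xs + count p ys
    count-++ p []       ys = refl
    count-++ p (x ∷ xs) ys = trans (cong (iverson (p x) +_) (count-++ p xs ys))
                                   (sym (ℕ.+-assoc (iverson (p x)) (count p xs) (count p ys)))

    count-map : ∀ {B : Set} (p : B → Bool) (f : A → B) xs → count p (map f xs) ≡ count (p ∘ f) xs
    count-map p f []       = refl
    count-map p f (x ∷ xs) = cong (iverson (p (f x)) +_) (count-map p f xs)

    count-∧ˡ : ∀ b (p : A → Bool) xs → count (λ x → b ∧ p x) xs ≡ iverson b * count p xs
    count-∧ˡ true  p xs       = sym (ℕ.+-identityʳ (count p xs))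
    count-∧ˡ false p []       = refl
    count-∧ˡ false p (x ∷ xs) = count-∧ˡ false p xs

    count-+ : {p q r : A → Bool} → (∀ x → iverson (r x) ≡ iverson (p x) + iverson (q x)) →
              ∀ xs → count r xs ≡ count p xs + count q xs
    count-+ split []                 = refl
    count-+ {p} {q} split (x ∷ xs) = trans (cong₂ _+_ (split x) (count-+ split xs))
      (+-interchange (iverson (p x)) (iverson (q x)) (count p xs) (count q xs))

    count≤length : ∀ (p : A → Bool) xs → count p xs ≤ length xs
    count≤length p []       = z≤n
    count≤length p (x ∷ xs) with p x
    ... | true  = s≤s (count≤length p xs)
    ... | false = ℕ.m≤n⇒m≤1+n (count≤length p xs)

    count-filter : ∀ (p q : A → Bool) → (∀ x → T (q x) → T (p x)) →
                   ∀ xs → count q (filter (λ x → p x Bool.≟ true) xs) ≡ count q xs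
    count-filter p q q⇒p []       = refl
    count-filter p q q⇒p (x ∷ xs) with p x in px
    ... | true  = cong (iverson (q x) +_) (count-filter p q q⇒p xs)
    ... | false = trans (count-filter p q q⇒p xs)
                        (cong (_+ count q xs) (sym (iverson-¬T (λ qx → subst T px (q⇒p x qx)))))

    sum-map+count : ∀ (g : A → ℕ) (q : A → Bool) {k xs} → All (λ x → g x + iverson (q x) ≡ k) xs →
                    sum (map g xs) + count q xs ≡ k * length xs
    sum-map+count g q {k} []                             = sym (ℕ.*-zeroʳ k)
    sum-map+count g q {k} {x ∷ xs} (gx+qx≡k ∷ g+q≡k) = begin
      (g x + sum (map g xs)) + (iverson (q x) + count q xs)
        ≡⟨ +-interchange (g x) (sum (map g xs)) (iverson (q x)) (count q xs) ⟩
      (g x + iverson (q x)) + (sum (map g xs) + count q xs)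
        ≡⟨ cong₂ _+_ gx+qx≡k (sum-map+count g q g+q≡k) ⟩
      k + k * length xs
        ≡⟨ ℕ.*-suc k (length xs) ⟨
      k * length (x ∷ xs) ∎
      where open ≡-Reasoning

  Unique-All≡⇒≡[_] : ∀ {A : Set} (b : A) {ys} → Unique ys → All (_≡ b) ys → b ∈ ys → ys ≡ b ∷ []
  Unique-All≡⇒≡[ b ] (_ ∷ _)         (refl ∷ [])       _ = refl
  Unique-All≡⇒≡[ b ] ((y≢z ∷ _) ∷ _) (refl ∷ refl ∷ _) _ = ⊥-elim (y≢z refl)

  module _ {A : Set} (_≟_ : DecidableEquality A) where

    open import Data.List.Relation.Unary.Unique.DecPropositional.Properties _≟_
      using (deduplicate-!)

    count-≟-absent : ∀ {x xs} → All (_≢ x) xs → count (λ y → ⌊ y ≟ x ⌋) xs ≡ 0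
    count-≟-absent []                           = refl
    count-≟-absent {x} {y ∷ _} (y≢x ∷ ys≢x) =
      cong₂ _+_ (cong iverson (⌊⌋-false (y ≟ x) y≢x)) (count-≟-absent ys≢x)

    count-≟-Unique : ∀ {x xs} → Unique xs → x ∈ xs → count (λ y → ⌊ y ≟ x ⌋) xs ≡ 1
    count-≟-Unique {x} (x≢ys ∷ _) (here refl) =
      cong₂ _+_ (cong iverson (⌊⌋-true (x ≟ x) refl))
                (count-≟-absent (All.map (λ x≢y y≡x → x≢y (sym y≡x)) x≢ys))
    count-≟-Unique {x} {y ∷ _} (y≢ys ∷ ys!) (there x∈ys) =
      cong₂ _+_ (cong iverson (⌊⌋-false (y ≟ x) (All.lookup y≢ys x∈ys))) (count-≟-Unique ys! x∈ys)

    -- deduplicate (a ∷ xs) is a followed by the duplicate-free list of the values ≠ a of xs,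
    -- all of which equal b.
    length-deduplicate-two-valued : ∀ {a b xs} → a ≢ b → All (λ y → y ≡ a ⊎ y ≡ b) xs →
      length (deduplicate _≟_ (a ∷ xs)) + iverson (all (λ y → ⌊ y ≟ a ⌋) xs) ≡ 2
    length-deduplicate-two-valued {a} {b} {xs} a≢b xs⊆ab = by-cases (any? (b ≟_) xs)
      where
      rest : List A
      rest = filter (λ y → ¬? (a ≟ y)) (deduplicate _≟_ xs)

      rest⊆b : All (_≡ b) rest
      rest⊆b = All.zipWith (λ where (a≢y , inj₁ y≡a) → ⊥-elim (a≢y (sym y≡a))
                                    (_   , inj₂ y≡b) → y≡b)
                 ( All.all-filter _ (deduplicate _≟_ xs)
                 , All.filter⁺ _ (All.deduplicate⁺ _≟_ xs⊆ab))

      by-cases : Dec (b ∈ xs) → suc (length rest) + iverson (all (λ y → ⌊ y ≟ a ⌋) xs) ≡ 2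
      by-cases (yes b∈xs) = cong₂ _+_ (cong (suc ∘ length) rest≡[b]) (iverson-¬T ¬all≡a)
        where
        rest≡[b] : rest ≡ b ∷ []
        rest≡[b] = Unique-All≡⇒≡[ b ] (Unique.filter⁺ _ (deduplicate-! xs)) rest⊆b
                     (∈-filter⁺ (λ y → ¬? (a ≟ y)) (∈-deduplicate⁺ _≟_ b∈xs) a≢b)
        ¬all≡a : ¬ T (all (λ y → ⌊ y ≟ a ⌋) xs)
        ¬all≡a all≡a = a≢b (sym (toWitness (All.lookup (All.all⁺ _ xs all≡a) b∈xs)))
      by-cases (no b∉xs) = cong₂ _+_ (cong (suc ∘ length) rest≡[])
                                      (iverson-T (All.all⁻ _ (All.map fromWitness xs≡a)))
        where
        xs≡a : All (_≡ a) xs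
        xs≡a = All.tabulate λ {y} y∈xs →
          [ id , (λ y≡b → ⊥-elim (b∉xs (subst (_∈ xs) y≡b y∈xs))) ]′
            (All.lookup xs⊆ab y∈xs)
        rest≡[] : rest ≡ []
        rest≡[] = filter-none (λ y → ¬? (a ≟ y))
                    (All.map (λ y≡a a≢y → a≢y (sym y≡a)) (All.deduplicate⁺ _≟_ xs≡a))

module CompleteGraph where

  open import Defs
  open Counting
  open import Data.Bool using (Bool; true; false; T; _∧_; _∨_; not)
  open import Data.Bool.ListAction using (all)
  open import Data.Bool.Properties using (T-∧; T-≡; T-not-≡)
  open import Data.Empty using (⊥-elim)
  open import Data.Fin as Fin using (Fin)
  open import Data.Integer as ℤ using (ℤ; +_; -[1+_]; +[1+_])
  import Data.Integer.Properties as ℤ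
  open import Algebra.Properties.AbelianGroup ℤ.+-0-abelianGroup
    using () renaming (∙-cancelʳ to +-cancelʳ)
  open import Data.List using (List; []; _∷_; map; concatMap; length; _++_; allFin)
  open import Data.List.Membership.Propositional using (_∈_)
  open import Data.List.Membership.Propositional.Properties using (∈-map⁺; ∈-upTo⁺; ∈-allFin)
  open import Data.List.Relation.Unary.All as All using (All; _∷_)
  import Data.List.Relation.Unary.All.Properties as All
  open import Data.List.Relation.Unary.Any using (here; any?)
  open import Data.List.Relation.Unary.Unique.Propositional using (Unique)
  import Data.List.Relation.Unary.Unique.Propositional.Properties as Unique
  open import Data.Nat using (ℕ; zero; suc; _+_; _*_; _∸_; _^_; _≤_; _<_; z≤n; s≤s)
  import Data.Nat.Properties as ℕ
  open import Data.Nat.ListAction using (sum)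
  open import Data.Product using (_×_; _,_; proj₁; proj₂; ∃-syntax)
  import Data.Rational as ℚ
  import Data.Rational.Properties as ℚ
  open import Data.Rational.Unnormalised as ℚᵘ using (mkℚᵘ; *≡*)
  import Data.Rational.Unnormalised.Properties as ℚᵘ
  open import Data.Sum using (_⊎_; inj₁; inj₂; [_,_]′)
  open import Data.Vec using (Vec; _∷_; lookup; toList)
  import Data.Vec.Membership.Propositional.Properties as Vec∈
  import Data.Vec.Relation.Unary.Any as Vecᴬ
  import Data.Vec.Relation.Unary.Any.Properties as Vecᴬ
  open import Function using (_∘_)
  open import Function.Bundles using (Equivalence)
  open import Relation.Binary.PropositionalEquality
    using (_≡_; _≢_; refl; sym; trans; cong; cong₂; subst; subst₂; module ≡-Reasoning)
  open import Relation.Nullary using (yes; no)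
  open import Relation.Nullary.Decidable using (⌊_⌋; toWitness; fromWitness)

  _⊗_ : ∀ {k} → (ℤ → Bool) → (Vec ℤ k → Bool) → Vec ℤ (suc k) → Bool
  (p ⊗ q) (x ∷ v) = p x ∧ q v

  count-allVecs-⊗ : ∀ k (p : ℤ → Bool) (q : Vec ℤ k → Bool) W →
                    count (p ⊗ q) (allVecs (suc k) W) ≡ count p W * count q (allVecs k W)
  count-allVecs-⊗ k p q W = go W
    where
    vs = allVecs k W
    go : ∀ xs → count (p ⊗ q) (concatMap (λ x → map (x ∷_) vs) xs) ≡ count p xs * count q vs
    go []       = refl
    go (x ∷ xs) = begin
      count (p ⊗ q) (map (x ∷_) vs ++ concatMap (λ x → map (x ∷_) vs) xs)
        ≡⟨ count-++ (p ⊗ q) (map (x ∷_) vs) _ ⟩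
      count (p ⊗ q) (map (x ∷_) vs) + count (p ⊗ q) (concatMap (λ x → map (x ∷_) vs) xs)
        ≡⟨ cong₂ _+_ (trans (count-map (p ⊗ q) (x ∷_) vs) (count-∧ˡ (p x) q vs)) (go xs) ⟩
      iverson (p x) * count q vs + count p xs * count q vs
        ≡⟨ ℕ.*-distribʳ-+ (count q vs) (iverson (p x)) (count p xs) ⟨
      count p (x ∷ xs) * count q vs ∎
      where open ≡-Reasoning

  count-allVecs-all : ∀ k (p : ℤ → Bool) W → count (all p ∘ toList) (allVecs k W) ≡ count p W ^ k
  count-allVecs-all zero    p W = refl
  count-allVecs-all (suc k) p W = begin
    count (all p ∘ toList) (allVecs (suc k) W)
      ≡⟨ count-cong (λ { (x ∷ v) → refl }) (allVecs (suc k) W) ⟩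
    count (p ⊗ (all p ∘ toList)) (allVecs (suc k) W)
      ≡⟨ count-allVecs-⊗ k p (all p ∘ toList) W ⟩
    count p W * count (all p ∘ toList) (allVecs k W)
      ≡⟨ cong (count p W *_) (count-allVecs-all k p W) ⟩
    count p W ^ suc k ∎
    where open ≡-Reasoning

  window-Unique : ∀ n → Unique (window n)
  window-Unique n = Unique.map⁺ (λ {a} {b} eq → ℤ.+-injective (+-cancelʳ (ℤ.- + n) (+ a) (+ b) eq))
                                (Unique.upTo⁺ (suc (2 * n)))

  ∈-window : ∀ {j n} → j ≤ n → + j ∈ window n
  ∈-window {j} {n} j≤n =
    subst (_∈ window n) shift (∈-map⁺ (λ k → + k ℤ.- + n) (∈-upTo⁺ (s≤s j+n≤2n)))
    where
    j+n≤2n : j + n ≤ 2 * n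
    j+n≤2n = ℕ.+-mono-≤ j≤n (ℕ.m≤m+n n 0)
    shift : + (j + n) ℤ.- + n ≡ + j
    shift = begin
      + (j + n) ℤ.- + n ≡⟨ ℤ.m-n≡m⊖n (j + n) n ⟩
      (j + n) ℤ.⊖ n     ≡⟨ ℤ.⊖-≥ (ℕ.m≤n+m n j) ⟩
      + (j + n ∸ n)     ≡⟨ cong +_ (ℕ.m+n∸n≡m j n) ⟩
      + j               ∎
      where open ≡-Reasoning

  count-window : ∀ n {j} → j ≤ n → count (λ y → ⌊ y ℤ.≟ + j ⌋) (window n) ≡ 1
  count-window n j≤n = count-≟-Unique ℤ._≟_ (window-Unique n) (∈-window j≤n)

  isZero : ℤ → Bool
  isZero y = ⌊ y ℤ.≟ + 0 ⌋

  isOne : ℤ → Bool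
  isOne y = ⌊ y ℤ.≟ + 1 ⌋

  isBit : ℤ → Bool
  isBit y = isZero y ∨ isOne y

  count-isBit-window : ∀ {n} → 1 ≤ n → count isBit (window n) ≡ 2
  count-isBit-window {n} 1≤n =
    trans (count-+ {p = isZero} {q = isOne} iverson-isBit (window n))
          (cong₂ _+_ (count-window n z≤n) (count-window n 1≤n))
    where
    iverson-isBit : ∀ y → iverson (isBit y) ≡ iverson (isZero y) + iverson (isOne y)
    iverson-isBit (+ 0)        = refl
    iverson-isBit (+ 1)        = refl
    iverson-isBit +[1+ suc _ ] = refl
    iverson-isBit -[1+ _ ]     = refl

  T-∨-introˡ : ∀ {a} b → T a → T (a ∨ b)
  T-∨-introˡ {true} _ _ = _

  T-∨-introʳ : ∀ a {b} → T b → T (a ∨ b)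
  T-∨-introʳ true  _  = _
  T-∨-introʳ false tb = tb

  T-not-∨⇒ : ∀ {a b} → T (not a ∨ b) → T a → T b
  T-not-∨⇒ {true} tb _ = tb

  close-refl : ∀ a → T (close a a)
  close-refl a = subst (λ d → T ⌊ ℤ.∣ d ∣ ℕ.≤? 1 ⌋) (sym (ℤ.+-inverseʳ a)) _

  close-to-0 : ∀ y → T (close (+ 0) y) → y ≡ + 0 ⊎ y ≡ + 1 ⊎ y ≡ -[1+ 0 ]
  close-to-0 (+ 0)        _ = inj₁ refl
  close-to-0 (+ 1)        _ = inj₂ (inj₁ refl)
  close-to-0 +[1+ suc _ ] ()
  close-to-0 -[1+ 0 ]     _ = inj₂ (inj₂ refl)
  close-to-0 -[1+ suc _ ] ()

  bits-close : ∀ y z → T (isBit y) → T (isBit z) → T (close y z)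
  bits-close (+ 0)        (+ 0)        _ _ = _
  bits-close (+ 0)        (+ 1)        _ _ = _
  bits-close (+ 1)        (+ 0)        _ _ = _
  bits-close (+ 1)        (+ 1)        _ _ = _
  bits-close (+ 0)        +[1+ suc _ ] _ ()
  bits-close (+ 0)        -[1+ _ ]     _ ()
  bits-close (+ 1)        +[1+ suc _ ] _ ()
  bits-close (+ 1)        -[1+ _ ]     _ ()
  bits-close +[1+ suc _ ] _            () _
  bits-close -[1+ _ ]     _            () _

  PairwiseClose : List ℤ → Set
  PairwiseClose ys = ∀ {y z} → y ∈ ys → z ∈ ys → T (close y z)

  -- 1 and -1 are at distance 2, so at most one of them occurs.
  two-valued : ∀ {ys} → + 0 ∈ ys → PairwiseClose ys →
               ∃[ e ] + 0 ≢ e × All (λ y → y ≡ + 0 ⊎ y ≡ e) ys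
  two-valued {ys} 0∈ys ys-close with any? (+ 1 ℤ.≟_) ys
  ... | yes 1∈ys = + 1 , (λ ()) , All.tabulate λ {y} y∈ys →
        [ inj₁ , [ inj₂ , (λ y≡-1 → ⊥-elim (ys-close 1∈ys (subst (_∈ ys) y≡-1 y∈ys))) ]′ ]′
          (close-to-0 y (ys-close 0∈ys y∈ys))
  ... | no 1∉ys  = -[1+ 0 ] , (λ ()) , All.tabulate λ {y} y∈ys →
        [ inj₁ , [ (λ y≡1 → ⊥-elim (1∉ys (subst (_∈ ys) y≡1 y∈ys))) , inj₂ ]′ ]′
          (close-to-0 y (ys-close 0∈ys y∈ys))

  module _ {n : ℕ} {G : Adj (suc n)} {f : Vec ℤ (suc n)} where

    private
      rooted : Bool
      rooted = ⌊ lookup f Fin.zero ℤ.≟ + 0 ⌋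
      edge : Fin (suc n) → Fin (suc n) → Bool
      edge i j = not (G i j) ∨ close (lookup f i) (lookup f j)
      row : Fin (suc n) → Bool
      row i = all (edge i) (allFin (suc n))

    isLip-root : T (isLip G f) → lookup f Fin.zero ≡ + 0
    isLip-root lip = toWitness (proj₁ (Equivalence.to (T-∧ {rooted}) lip))

    isLip-edge : T (isLip G f) → ∀ i j → T (G i j) → T (close (lookup f i) (lookup f j))
    isLip-edge lip i j = T-not-∨⇒ (All.lookup (All.all⁺ (edge i) _ row-i) (∈-allFin j))
      where
      row-i : T (row i)
      row-i = All.lookup (All.all⁺ row _ (proj₂ (Equivalence.to (T-∧ {rooted}) lip))) (∈-allFin i)

    isLip-intro : lookup f Fin.zero ≡ + 0 → PairwiseClose (toList f) → T (isLip G f)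
    isLip-intro f0≡0 f-close = Equivalence.from (T-∧ {rooted}) (fromWitness f0≡0 ,
      All.all⁻ row {allFin (suc n)} (All.tabulate λ {i} _ →
        All.all⁻ (edge i) {allFin (suc n)} (All.tabulate λ {j} _ →
          T-∨-introʳ (not (G i j)) (f-close (∈-lookup i) (∈-lookup j)))))
      where
      ∈-lookup : ∀ i → lookup f i ∈ toList f
      ∈-lookup i = Vec∈.∈-toList⁺ (Vec∈.∈-lookup i f)

  isLip-complete⇒PairwiseClose : ∀ {n} {f : Vec ℤ (suc n)} →
                                 T (isLip (complete (suc n)) f) → PairwiseClose (toList f)
  isLip-complete⇒PairwiseClose {f = f} lip y∈f z∈f =
    subst₂ (λ y z → T (close y z)) (sym (Vecᴬ.lookup-index p)) (sym (Vecᴬ.lookup-index q))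
           (close-at (Vecᴬ.index p) (Vecᴬ.index q))
    where
    p = Vec∈.∈-toList⁻ y∈f
    q = Vec∈.∈-toList⁻ z∈f
    close-at : ∀ i j → T (close (lookup f i) (lookup f j))
    close-at i j with i Fin.≟ j
    ... | yes refl = close-refl (lookup f i)
    ... | no i≢j   = isLip-edge {G = complete _} {f = f} lip i j
                       (Equivalence.from T-not-≡ (⌊⌋-false (i Fin.≟ j) i≢j))

  isZeroMap : ∀ {k} → Vec ℤ k → Bool
  isZeroMap = all isZero ∘ toList

  isRootedBitMap : ∀ {k} → Vec ℤ (suc k) → Bool
  isRootedBitMap = isZero ⊗ (all isBit ∘ toList)

  rng+isZeroMap≡2 : ∀ {n} (f : Vec ℤ (suc n)) → T (isLip (complete (suc n)) f) →
                    rng f + iverson (isZeroMap f) ≡ 2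
  rng+isZeroMap≡2 (x ∷ v) lip with isLip-root {f = x ∷ v} lip
  ... | refl with two-valued (here refl) (isLip-complete⇒PairwiseClose lip)
  ...   | e , 0≢e , _ ∷ v⊆0e = length-deduplicate-two-valued ℤ._≟_ {xs = toList v} 0≢e v⊆0e

  isZeroMap⇒isRootedBitMap : ∀ {k} (f : Vec ℤ (suc k)) → T (isZeroMap f) → T (isRootedBitMap f)
  isZeroMap⇒isRootedBitMap (x ∷ v) zero-map with Equivalence.to (T-∧ {isZero x}) zero-map
  ... | x≡0 , v≡0 =
    Equivalence.from T-∧
      (x≡0 , All.all⁻ isBit {toList v} (All.map (T-∨-introˡ _) (All.all⁺ isZero _ v≡0)))

  isRootedBitMap⇒isLip : ∀ {n} (G : Adj (suc n)) (f : Vec ℤ (suc n)) →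
                         T (isRootedBitMap f) → T (isLip G f)
  isRootedBitMap⇒isLip G (x ∷ v) bit-map with Equivalence.to (T-∧ {isZero x}) bit-map
  ... | x≡0 , v-bits =
    isLip-intro (toWitness x≡0)
      (λ {y} {z} y∈f z∈f → bits-close y z (All.lookup bits y∈f) (All.lookup bits z∈f))
    where
    bits : All (T ∘ isBit) (x ∷ toList v)
    bits = T-∨-introˡ _ x≡0 ∷ All.all⁺ isBit _ v-bits

  sum-rng-L1-complete : ∀ n →
    sum (map rng (L1 (complete (suc n)))) + 1 ≡ 2 * length (L1 (complete (suc n)))
  sum-rng-L1-complete n = begin
    sum (map rng L) + 1                  ≡⟨ cong (λ k → sum (map rng L) + k) zero-maps ⟨
    sum (map rng L) + count isZeroMap L  ≡⟨ sum-map+count rng isZeroMap rng+isZeroMap≡2-on-L ⟩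
    2 * length L                         ∎
    where
    open ≡-Reasoning
    A = allVecs (suc n) (window n)
    L = L1 (complete (suc n))
    rng+isZeroMap≡2-on-L : All (λ f → rng f + iverson (isZeroMap f) ≡ 2) L
    rng+isZeroMap≡2-on-L = All.map (λ {f} lip → rng+isZeroMap≡2 f (Equivalence.from T-≡ lip))
                                   (All.all-filter _ A)
    zero⇒lip : ∀ f → T (isZeroMap f) → T (isLip (complete (suc n)) f)
    zero⇒lip f = isRootedBitMap⇒isLip _ f ∘ isZeroMap⇒isRootedBitMap f
    zero-maps : count isZeroMap L ≡ 1
    zero-maps = begin
      count isZeroMap L                ≡⟨ count-filter (isLip (complete (suc n))) isZeroMap zero⇒lip A ⟩
      count isZeroMap A                ≡⟨ count-allVecs-all (suc n) isZero (window n) ⟩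
      count isZero (window n) ^ suc n  ≡⟨ cong (_^ suc n) (count-window n z≤n) ⟩
      1 ^ suc n                        ≡⟨ ℕ.^-zeroˡ (suc n) ⟩
      1                                ∎

  2^n≤length-L1-complete : ∀ {n} → 1 ≤ n → 2 ^ n ≤ length (L1 (complete (suc n)))
  2^n≤length-L1-complete {n} 1≤n = begin
    2 ^ n                   ≡⟨ rooted-bit-maps ⟨
    count isRootedBitMap L  ≤⟨ count≤length isRootedBitMap L ⟩
    length L                ∎
    where
    open ℕ.≤-Reasoning
    A = allVecs (suc n) (window n)
    L = L1 (complete (suc n))
    rooted-bit-maps : count isRootedBitMap L ≡ 2 ^ n
    rooted-bit-maps = begin-equality
      count isRootedBitMap L
        ≡⟨ count-filter (isLip (complete (suc n))) isRootedBitMap (isRootedBitMap⇒isLip _) A ⟩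
      count isRootedBitMap A      ≡⟨ count-allVecs-⊗ n isZero (all isBit ∘ toList) (window n) ⟩
      count isZero (window n) * count (all isBit ∘ toList) (allVecs n (window n))
        ≡⟨ cong₂ _*_ (count-window n z≤n) (count-allVecs-all n isBit (window n)) ⟩
      1 * count isBit (window n) ^ n  ≡⟨ ℕ.*-identityˡ _ ⟩
      count isBit (window n) ^ n      ≡⟨ cong (_^ n) (count-isBit-window 1≤n) ⟩
      2 ^ n                           ∎

  n<2^n : ∀ n → n < 2 ^ n
  n<2^n zero    = s≤s z≤n
  n<2^n (suc n) = ℕ.+-mono-≤ (ℕ.m^n>0 2 n) (ℕ.≤-trans (n<2^n n) (ℕ.m≤m+n (2 ^ n) 0))

  length-L1-complete-> : ∀ {N n} → N < n → N < length (L1 (complete (suc n)))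
  length-L1-complete-> {N} {n} N<n = begin-strict
    N                              <⟨ N<n ⟩
    n                              <⟨ n<2^n n ⟩
    2 ^ n                          ≤⟨ 2^n≤length-L1-complete (ℕ.≤-trans (s≤s z≤n) N<n) ⟩
    length (L1 (complete (suc n))) ∎
    where open ℕ.≤-Reasoning

  s/c-2≃-1/c : ∀ s c → s + 1 ≡ 2 * suc c → mkℚᵘ (+ s) c ℚᵘ.- mkℚᵘ (+ 2) 0 ℚᵘ.≃ mkℚᵘ -[1+ 0 ] c
  s/c-2≃-1/c s c s+1≡2c = *≡* (cong₂ ℤ._*_ numerator (cong +_ (sym (ℕ.*-identityʳ (suc c)))))
    where
    numerator : + s ℤ.* ℤ.1ℤ ℤ.+ -[1+ 1 ] ℤ.* + suc c ≡ -[1+ 0 ]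
    numerator = begin
      + s ℤ.* ℤ.1ℤ ℤ.+ -[1+ 1 ] ℤ.* + suc c
        ≡⟨ cong₂ ℤ._+_ (ℤ.*-identityʳ (+ s)) (sym (ℤ.neg-distribˡ-* (+ 2) (+ suc c))) ⟩
      + s ℤ.- + 2 ℤ.* + suc c   ≡⟨ cong (λ t → + s ℤ.- t) (ℤ.pos-* 2 (suc c)) ⟨
      + s ℤ.- + (2 * suc c)     ≡⟨ cong (λ t → + s ℤ.- + t) s+1≡2c ⟨
      + s ℤ.- + (s + 1)         ≡⟨ ℤ.m-n≡m⊖n s (s + 1) ⟩
      s ℤ.⊖ (s + 1)             ≡⟨ ℤ.⊖-≤ (ℕ.m≤m+n s 1) ⟩
      ℤ.- + (s + 1 ∸ s)         ≡⟨ cong (λ t → ℤ.- + t) (ℕ.m+n∸m≡n s 1) ⟩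
      -[1+ 0 ]                  ∎
      where open ≡-Reasoning

  toℚᵘ-∣avg-2∣ : ∀ s c → s + 1 ≡ 2 * suc c →
                 ℚ.toℚᵘ ℚ.∣ divℕ s (suc c) ℚ.- (ℚ.1ℚ ℚ.+ ℚ.1ℚ) ∣ ℚᵘ.≃ mkℚᵘ (+ 1) c
  toℚᵘ-∣avg-2∣ s c s+1≡2c = begin
    ℚ.toℚᵘ ℚ.∣ avg ℚ.- 2ℚ ∣                              ≈⟨ ℚ.toℚᵘ-homo-∣-∣ (avg ℚ.- 2ℚ) ⟩
    ℚᵘ.∣ ℚ.toℚᵘ (avg ℚ.- 2ℚ) ∣                          ≈⟨ ℚᵘ.∣-∣-cong (ℚ.toℚᵘ-homo-+ avg (ℚ.- 2ℚ)) ⟩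
    ℚᵘ.∣ ℚ.toℚᵘ avg ℚᵘ.+ ℚ.toℚᵘ (ℚ.- 2ℚ) ∣
      ≈⟨ ℚᵘ.∣-∣-cong (ℚᵘ.+-cong (ℚ.toℚᵘ-fromℚᵘ (mkℚᵘ (+ s) c)) (ℚ.toℚᵘ-homo‿- 2ℚ)) ⟩
    ℚᵘ.∣ mkℚᵘ (+ s) c ℚᵘ.- mkℚᵘ (+ 2) 0 ∣                ≈⟨ ℚᵘ.∣-∣-cong (s/c-2≃-1/c s c s+1≡2c) ⟩
    mkℚᵘ (+ 1) c                                         ∎
    where
    open ℚᵘ.≃-Reasoning
    avg = divℕ s (suc c)
    2ℚ = ℚ.1ℚ ℚ.+ ℚ.1ℚ

  avg-near-2 : ∀ {s c} (ε : ℚ.ℚ) → ℚ.0ℚ ℚ.< ε → s + 1 ≡ 2 * c → ℚ.↧ₙ ε < c →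
               ℚ.∣ divℕ s c ℚ.- (ℚ.1ℚ ℚ.+ ℚ.1ℚ) ∣ ℚ.< ε
  avg-near-2 (ℚ.mkℚ (+ 0) _ _)    (ℚ.*<* (ℤ.+<+ ()))
  avg-near-2 (ℚ.mkℚ -[1+ _ ] _ _) (ℚ.*<* ())
  avg-near-2 {s} {suc c} (ℚ.mkℚ +[1+ p ] d _) _ s+1≡2c d<c =
    ℚ.toℚᵘ-cancel-< (ℚᵘ.<-respˡ-≃ (ℚᵘ.≃-sym (toℚᵘ-∣avg-2∣ s c s+1≡2c)) 1/c<ε)
    where
    1/c<ε : mkℚᵘ (+ 1) c ℚᵘ.< mkℚᵘ +[1+ p ] d
    1/c<ε = ℚᵘ.*<* (subst (ℤ._< + (suc c + p * suc c)) (sym (ℤ.*-identityˡ (+ suc d)))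
                         (ℤ.+<+ (ℕ.<-≤-trans d<c (ℕ.m≤m+n (suc c) (p * suc c)))))

open import Defs
open import Data.Nat using (ℕ; suc; _≤_)
open import Data.Rational using (ℚ; _<_; _-_; ∣_∣; 0ℚ; 1ℚ; _+_; ↧ₙ_)
open import Data.Product using (∃; _,_)
open CompleteGraph using (avg-near-2; sum-rng-L1-complete; length-L1-complete->)

corollary1 : ∀ (ε : ℚ) → 0ℚ < ε → ∃ λ (N : ℕ) → ∀ (n : ℕ) → N ≤ n →
    ∣ avg1 (complete (suc n)) - (1ℚ + 1ℚ) ∣ < ε
corollary1 ε 0<ε = suc (↧ₙ ε) , λ n N≤n →
  avg-near-2 ε 0<ε (sum-rng-L1-complete n) (length-L1-complete-> N≤n)
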